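{- (Rhombus property.) For all integers $n,r>0$, $$\det\begin{pmatrix}H(n,r)&H(n,r+1)\\H(n+1,r)&H(n+1,r+1)\end{pmatrix}=(-1)^{n-r+1}F_rF_{r+1},$$ where $H(a,b)=F_bF_{a-b}$.
   Context: $F_n$ denotes the Fibonacci numbers, $F_0=0$, $F_1=1$, $F_n=F_{n-1}+F_{n-2}$, extended to negative indices by $F_{ -m}=(-1)^{m+1}F_m$ (relevant only if an index is negative). $H(a,b)=F_bF_{a-b}$ is the entry in row $a$, position $b$ of the Hosoya triangle. -}

module Defs where

open import Data.Nat using (ℕ; zero; suc)
open import Data.Integer using (ℤ; +_; -[1+_]; _+_; _*_; _-_; -_)

fibℕ : ℕ → ℕ
fibℕ zero = zero
fibℕ (suc zero) = suc zero
fibℕ (suc (suc n)) = fibℕ (suc n) Data.Nat.+ fibℕ n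

negOnePowℕ : ℕ → ℤ
negOnePowℕ zero = + 1
negOnePowℕ (suc m) = - negOnePowℕ m

-- Fibonacci numbers extended to ℤ: F_{-m} = (-1)^{m+1} F_m
F : ℤ → ℤ
F (+ n) = + fibℕ n
F -[1+ m ] = negOnePowℕ (suc (suc m)) * (+ fibℕ (suc m))

-- (-1)^k for an integer exponent k (depends only on parity)
negOnePow : ℤ → ℤ
negOnePow (+ n) = negOnePowℕ n
negOnePow -[1+ m ] = negOnePowℕ (suc m)

H : ℤ → ℤ → ℤ
H a b = F b * F (a - b)

det2 : ℤ → ℤ → ℤ → ℤ → ℤ
det2 a b c d = a * d - b * c

module Submission where

-- Writing k = a - b, the four entries are F_b F_k, F_{b+1} F_{k-1}, F_b F_{k+1}
-- and F_{b+1} F_k, so the determinant factors as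
-- (F_k F_k - F_{k-1} F_{k+1}) F_b F_{b+1}, and the first factor is Cassini's
-- identity F_k^2 - F_{k-1} F_{k+1} = (-1)^(k+1), valid for every integer k.

open import Defs
open import Data.Nat using (ℕ; suc; zero)
import Data.Nat.Properties as ℕ
open import Data.Integer using (ℤ; +_; -[1+_]; _+_; _*_; _-_; -_)
open import Data.Integer.Properties using (neg-involutive)
open import Data.Integer.Tactic.RingSolver using (solve-∀)
open import Relation.Binary.PropositionalEquality
  using (_≡_; refl; sym; trans; cong; cong₂; subst; module ≡-Reasoning)

ℤ-induction : (P : ℤ → Set) → P (+ 0) →
              (∀ k → P k → P (k + + 1)) → (∀ k → P (k + + 1) → P k) →
              ∀ k → P k
ℤ-induction P base up down (+ zero)     = base
ℤ-induction P base up down (+ suc m)    =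
  subst P (cong +_ (ℕ.+-comm m 1)) (up (+ m) (ℤ-induction P base up down (+ m)))
ℤ-induction P base up down -[1+ zero ]  = down -[1+ zero ] base
ℤ-induction P base up down -[1+ suc m ] =
  down -[1+ suc m ] (ℤ-induction P base up down -[1+ m ])

k+1-1≡k : ∀ k → k + + 1 - + 1 ≡ k
k+1-1≡k = solve-∀

negOnePow-suc : ∀ k → negOnePow (k + + 1) ≡ - negOnePow k
negOnePow-suc (+ n) rewrite ℕ.+-comm n 1 = refl
negOnePow-suc -[1+ zero ]  = refl
negOnePow-suc -[1+ suc m ] = sym (neg-involutive _)

-- The Fibonacci recurrence F_{k+1} = F_k + F_{k-1} holds on all of ℤ; on the
-- negative side it is the recurrence for F_m with alternating signs.
F-rec : ∀ k → F (k + + 1) ≡ F k + F (k - + 1)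
F-rec (+ zero)     = refl
F-rec (+ suc m)    rewrite ℕ.+-comm m 1 = refl
F-rec -[1+ zero ]  = refl
F-rec -[1+ suc m ] rewrite ℕ.+-identityʳ m =
  negative-side (negOnePowℕ (suc (suc m))) (+ fibℕ (suc m)) (+ fibℕ (suc (suc m)))
  where
  -- with s = (-1)^(m+2): s F_{m+1} = (-s) F_{m+2} + s (F_{m+2} + F_{m+1})
  negative-side : ∀ s x y → s * x ≡ (- s) * y + (- (- s)) * (y + x)
  negative-side = solve-∀

F-rec₂ : ∀ k → F (k + + 1 + + 1) ≡ F (k + + 1) + F k
F-rec₂ k = trans (F-rec (k + + 1)) (cong (λ j → F (k + + 1) + F j) (k+1-1≡k k))

cassiniExpr : ℤ → ℤ
cassiniExpr k = F k * F k - F (k - + 1) * F (k + + 1)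

-- Cassini's expression alternates in sign: with a = F_{k-1}, b = F_k it is
-- b² - a(a+b) at k and (a+b)² - b(a+2b) = -(b² - a(a+b)) at k + 1.
cassiniExpr-suc : ∀ k → cassiniExpr (k + + 1) ≡ - cassiniExpr k
cassiniExpr-suc k = begin
    F (k + + 1) * F (k + + 1) - F (k + + 1 - + 1) * F (k + + 1 + + 1)
  ≡⟨ cong (λ j → F (k + + 1) * F (k + + 1) - F j * F (k + + 1 + + 1)) (k+1-1≡k k) ⟩
    F (k + + 1) * F (k + + 1) - F k * F (k + + 1 + + 1)
  ≡⟨ cong (λ x → F (k + + 1) * F (k + + 1) - F k * x) (F-rec₂ k) ⟩
    F (k + + 1) * F (k + + 1) - F k * (F (k + + 1) + F k)
  ≡⟨ cong (λ x → x * x - F k * (x + F k)) (F-rec k) ⟩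
    (F k + F (k - + 1)) * (F k + F (k - + 1)) - F k * ((F k + F (k - + 1)) + F k)
  ≡⟨ alternation (F (k - + 1)) (F k) ⟩
    - (F k * F k - F (k - + 1) * (F k + F (k - + 1)))
  ≡⟨ cong (λ x → - (F k * F k - F (k - + 1) * x)) (sym (F-rec k)) ⟩
    - cassiniExpr k
  ∎
  where
  open ≡-Reasoning
  alternation : ∀ a b → (b + a) * (b + a) - b * ((b + a) + b) ≡ - (b * b - a * (b + a))
  alternation = solve-∀

cassini : ∀ k → cassiniExpr k ≡ negOnePow (k + + 1)
cassini = ℤ-induction (λ k → cassiniExpr k ≡ negOnePow (k + + 1)) refl up down
  where
  open ≡-Reasoning
  up : ∀ k → cassiniExpr k ≡ negOnePow (k + + 1) →
       cassiniExpr (k + + 1) ≡ negOnePow (k + + 1 + + 1)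
  up k ih = begin
    cassiniExpr (k + + 1)       ≡⟨ cassiniExpr-suc k ⟩
    - cassiniExpr k             ≡⟨ cong -_ ih ⟩
    - negOnePow (k + + 1)       ≡⟨ sym (negOnePow-suc (k + + 1)) ⟩
    negOnePow (k + + 1 + + 1)   ∎
  down : ∀ k → cassiniExpr (k + + 1) ≡ negOnePow (k + + 1 + + 1) →
         cassiniExpr k ≡ negOnePow (k + + 1)
  down k ih = begin
    cassiniExpr k                 ≡⟨ sym (neg-involutive _) ⟩
    - - cassiniExpr k             ≡⟨ cong -_ (sym (cassiniExpr-suc k)) ⟩
    - cassiniExpr (k + + 1)       ≡⟨ cong -_ ih ⟩
    - negOnePow (k + + 1 + + 1)   ≡⟨ cong -_ (negOnePow-suc (k + + 1)) ⟩
    - - negOnePow (k + + 1)       ≡⟨ neg-involutive _ ⟩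
    negOnePow (k + + 1)           ∎

H-right : ∀ a b → H a (b + + 1) ≡ F (b + + 1) * F (a - b - + 1)
H-right a b = cong (λ j → F (b + + 1) * F j) (index a b)
  where
  index : ∀ a b → a - (b + + 1) ≡ a - b - + 1
  index = solve-∀

H-below : ∀ a b → H (a + + 1) b ≡ F b * F (a - b + + 1)
H-below a b = cong (λ j → F b * F j) (index a b)
  where
  index : ∀ a b → a + + 1 - b ≡ a - b + + 1
  index = solve-∀

H-diagonal : ∀ a b → H (a + + 1) (b + + 1) ≡ F (b + + 1) * F (a - b)
H-diagonal a b = cong (λ j → F (b + + 1) * F j) (index a b)
  where
  index : ∀ a b → a + + 1 - (b + + 1) ≡ a - b
  index = solve-∀

det2-factor : ∀ p q x y z →
  det2 (p * y) (q * x) (p * z) (q * y) ≡ (y * y - x * z) * (p * q)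
det2-factor = factor
  where
  factor : ∀ p q x y z →
    p * y * (q * y) - q * x * (p * z) ≡ (y * y - x * z) * (p * q)
  factor = solve-∀

rhombus : ∀ a b →
  det2 (H a b) (H a (b + + 1)) (H (a + + 1) b) (H (a + + 1) (b + + 1))
    ≡ negOnePow (a - b + + 1) * (F b * F (b + + 1))
rhombus a b = begin
    det2 (H a b) (H a (b + + 1)) (H (a + + 1) b) (H (a + + 1) (b + + 1))
  ≡⟨ cong₂ (det2 (H a b) (H a (b + + 1))) (H-below a b) (H-diagonal a b) ⟩
    det2 (H a b) (H a (b + + 1)) (F b * F (k + + 1)) (F (b + + 1) * F k)
  ≡⟨ cong (λ x → det2 (H a b) x (F b * F (k + + 1)) (F (b + + 1) * F k)) (H-right a b) ⟩
    det2 (F b * F k) (F (b + + 1) * F (k - + 1)) (F b * F (k + + 1)) (F (b + + 1) * F k)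
  ≡⟨ det2-factor (F b) (F (b + + 1)) (F (k - + 1)) (F k) (F (k + + 1)) ⟩
    cassiniExpr k * (F b * F (b + + 1))
  ≡⟨ cong (_* (F b * F (b + + 1))) (cassini k) ⟩
    negOnePow (k + + 1) * (F b * F (b + + 1))
  ∎
  where
  open ≡-Reasoning
  k : ℤ
  k = a - b

mainTheorem4 : (n r : ℕ) →
    det2 (H (+ suc n) (+ suc r)) (H (+ suc n) (+ suc r + + 1))
         (H (+ suc n + + 1) (+ suc r)) (H (+ suc n + + 1) (+ suc r + + 1))
      ≡ negOnePow (+ suc n - + suc r + + 1) * (F (+ suc r) * F (+ suc r + + 1))
mainTheorem4 n r = rhombus (+ suc n) (+ suc r)
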